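{- Let $\lambda\in\mathbb{R}$ and $x$ an indeterminate. For all integers $n,k\ge0$ with $n\ge k$ and $n-k\equiv0\pmod2$, \[ T_{n,k}(x,x^2,\dots,x^{n-k+1}\mid\lambda)=x^nT_{n,k}(1,1,\dots,1\mid\lambda)=x^nT_{2,\lambda}(n,k), \] and \[ T_{2,\lambda}(n,k)=T_{n,k}(1,1,\dots,1\mid\lambda)=\sum\frac{n!}{i_1!i_2!\cdots i_{n-k+1}!}\prod_{j=1}^{n-k+1}\Big(\frac{(\tfrac12)_{j,\lambda}-(-1)^j\langle\tfrac12\rangle_{j,\lambda}}{j!}\Big)^{i_j}, \] where the sum is over all integers $i_1,\dots,i_{n-k+1}\ge0$ with $i_1+i_2+\cdots+i_{n-k+1}=k$ and $i_1+2i_2+\cdots+(n-k+1)i_{n-k+1}=n$ (so the factor for $j=1$ is $((\tfrac12)_{1,\lambda}+\langle\tfrac12\rangle_{1,\lambda})/1!$, for $j=2$ is $((\tfrac12)_{2,\lambda}-\langle\tfrac12\rangle_{2,\lambda})/2!$, etc.).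
   Context: For $\lambda\in\mathbb{R}$, $(x)_{0,\lambda}=1$, $(x)_{n,\lambda}=x(x-\lambda)\cdots(x-(n-1)\lambda)$ and $\langle x\rangle_{0,\lambda}=1$, $\langle x\rangle_{n,\lambda}=x(x+\lambda)\cdots(x+(n-1)\lambda)$ for $n\ge1$. The degenerate exponential is $e_\lambda^x(t)=(1+\lambda t)^{x/\lambda}$. The degenerate central factorial numbers of the second kind $T_{2,\lambda}(n,k)$ are defined for integers $k\ge0$ by $\frac{1}{k!}\big(e_\lambda^{1/2}(t)-e_\lambda^{ -1/2}(t)\big)^k=\sum_{n\ge k}T_{2,\lambda}(n,k)\frac{t^n}{n!}$. The degenerate central incomplete Bell polynomials $T_{n,k}(x_1,\dots,x_{n-k+1}\mid\lambda)$ are defined for integers $k\ge0$ by \[ \frac{1}{k!}\Big(\sum_{m=1}^\infty x_m\big((\tfrac12)_{m,\lambda}-(-1)^m\langle\tfrac12\rangle_{m,\lambda}\big)\frac{t^m}{m!}\Big)^k=\sum_{n=k}^\infty T_{n,k}(x_1,\dots,x_{n-k+1}\mid\lambda)\frac{t^n}{n!}. \] -}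

module Defs where

open import Algebra.Bundles using (CommutativeRing)
open import Data.Nat as ℕ using (ℕ; zero; suc; _∸_)
open import Data.Nat.Base using () renaming (_! to _ℕ!)
open import Data.List using (List; []; _∷_; map; concatMap; filter; upTo)
open import Data.Vec using (Vec; []; _∷_)
open import Relation.Nullary.Decidable using (_×-dec_)

module RingOps {c ℓ} (R : CommutativeRing c ℓ) where
  open CommutativeRing R

  ι : ℕ → Carrier
  ι zero = 0#
  ι (suc n) = 1# + ι n

  _^_ : Carrier → ℕ → Carrier
  a ^ zero = 1#
  a ^ suc n = a * (a ^ n)

  sumTo : (ℕ → Carrier) → ℕ → Carrier
  sumTo f zero = 0#
  sumTo f (suc n) = sumTo f n + f n

  sumList : List Carrier → Carrier
  sumList [] = 0#
  sumList (a ∷ as) = a + sumList as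

-- Ring R in which every positive integer (suc m) · 1# has inverse  inv m
-- (i.e. a ℚ-algebra), together with the parameter λ = lam.
module Ops {c ℓ} (R : CommutativeRing c ℓ) (inv : ℕ → CommutativeRing.Carrier R)
           (lam : CommutativeRing.Carrier R) where
  open CommutativeRing R
  open RingOps R

  half : Carrier
  half = inv 1

  fact : ℕ → Carrier
  fact n = ι (n ℕ!)

  invFact : ℕ → Carrier
  invFact zero = 1#
  invFact (suc n) = inv n * invFact n

  falling : Carrier → ℕ → Carrier
  falling y zero = 1#
  falling y (suc n) = falling y n * (y - ι n * lam)

  rising : Carrier → ℕ → Carrier
  rising y zero = 1#
  rising y (suc n) = rising y n * (y + ι n * lam)

  a : ℕ → Carrier
  a j = falling half j - ((- 1#) ^ j) * rising half j

  -- formal power series in t, given by ordinary coefficients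
  Series : Set c
  Series = ℕ → Carrier

  oneS : Series
  oneS zero = 1#
  oneS (suc _) = 0#

  mulS : Series → Series → Series
  mulS f g n = sumTo (λ i → f i * g (n ∸ i)) (suc n)

  powS : Series → ℕ → Series
  powS f zero = oneS
  powS f (suc k) = mulS f (powS f k)

  baseS : (ℕ → Carrier) → Series
  baseS x zero = 0#
  baseS x (suc m) = x (suc m) * a (suc m) * invFact (suc m)

  -- degenerate central incomplete Bell polynomial T_{n,k}(x_1,...,x_{n-k+1} | λ);
  -- x m stands for x_m (m ≥ 1; only x_1..x_{n-k+1} matter)
  T : ℕ → ℕ → (ℕ → Carrier) → Carrier
  T n k x = fact n * (invFact k * powS (baseS x) k n)

  -- e_λ^y(t) = (1 + λ t)^{y/λ} = Σ_m (y)_{m,λ} t^m / m!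
  expλ : Carrier → Series
  expλ y m = falling y m * invFact m

  diffS : Series
  diffS m = expλ half m - expλ (- half) m

  T2 : ℕ → ℕ → Carrier
  T2 n k = fact n * (invFact k * powS diffS k n)

  vecs : (len b : ℕ) → List (Vec ℕ len)
  vecs zero b = [] ∷ []
  vecs (suc l) b = concatMap (λ i → map (i ∷_) (vecs l b)) (upTo (suc b))

  sumV : ∀ {l} → Vec ℕ l → ℕ
  sumV [] = 0
  sumV (i ∷ v) = i ℕ.+ sumV v

  wsumFrom : ∀ {l} → ℕ → Vec ℕ l → ℕ
  wsumFrom j [] = 0
  wsumFrom j (i ∷ v) = j ℕ.* i ℕ.+ wsumFrom (suc j) v

  prodFrom : ∀ {l} → ℕ → Vec ℕ l → Carrier
  prodFrom j [] = 1#
  prodFrom j (i ∷ v) = invFact i * ((a j * invFact j) ^ i) * prodFrom (suc j) v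

  -- Σ over i_1,...,i_{n-k+1} ≥ 0 with Σ i_j = k, Σ j i_j = n of
  --   n!/(i_1! ... i_{n-k+1}!) Π_j (a_j / j!)^{i_j}
  -- (entries are bounded by k since their sum is k)
  multSum : ℕ → ℕ → Carrier
  multSum n k =
    sumList (map (λ v → fact n * prodFrom 1 v)
      (filter (λ v → (sumV v ℕ.≟ k) ×-dec (wsumFrom 1 v ℕ.≟ n))
              (vecs (suc (n ∸ k)) k)))

module Submission where

open import Defs
open import Algebra.Bundles using (CommutativeRing)
open import Data.Nat using (ℕ; suc; _≤_; _∸_)
open import Data.Nat.Divisibility using (_∣_)
open import Data.Product using (_×_)
open import Data.Nat as ℕ using (zero; z≤n; s≤s; _<_)
import Data.Nat.Properties as NP
open import Relation.Binary.PropositionalEquality as P using (_≡_)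
open import Data.Product using (_,_)
open import Data.Bool using (Bool; true; false)
open import Data.List using (List; []; _∷_; map; filter; concatMap; upTo; applyUpTo; _++_)
import Data.List.Properties as LP
open import Data.Vec using (Vec; []; _∷_)
open import Relation.Nullary using (Dec; yes; no; does; ¬_)
open import Relation.Nullary.Decidable using (_×-dec_; map′; does-≡; dec-false)
open import Data.Empty using (⊥-elim)
import Algebra.Properties.Ring as RingProperties
import Algebra.Properties.CommutativeSemigroup as CommSemigroupProperties

-- Put c_m = a_m / m!, so that with every x_m = 1 the series
-- Σ_{m≥1} x_m a_m t^m/m! is g_1 = Σ_{m≥1} c_m t^m.  The four claims are:
--  * homogeneity: x_m ↦ x^m scales the t^m coefficient by x^m, hence the t^n
--    coefficient of every power by x^n;
--  * e_λ^{1/2}(t) - e_λ^{-1/2}(t) = g_1, because (-1/2)_{m,λ} = (-1)^m ⟨1/2⟩_{m,λ};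
--  * the multinomial expansion of [t^n] g_1^k/k!.  With g_j = Σ_{m≥j} c_m t^m we
--    have g_j = c_j t^j + g_{j+1}, and the exponential binomial theorem
--      (α t^d + S)^k/k! = Σ_i (α^i/i!) t^{d i} S^{k-i}/(k-i)!
--    peels off the exponent i_j of c_j.  Induction on the number of exponents
--    turns [t^n] g_j^k/k! into the constrained sum over (i_j, i_{j+1}, …); once
--    j·k > n the remaining power has no t^n term, so n-k+1 exponents suffice.

-- Bounds on exponent vectors.  The hypothesis  n + 2 ≤ j + l + k  of the
-- expansion says that positions j, …, j+l-1 reach at least n - k + 1.
module ExponentBounds where
  open import Data.Nat using (_+_; _*_; NonZero)
  open import Data.Nat.Tactic.RingSolver using (solve-∀)

  bound-drop-first : ∀ N K i j l → .{{_ : NonZero j}} →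
    N + j * i + 2 ≤ j + suc l + (K + i) → N + 2 ≤ suc j + l + K
  bound-drop-first N K i j l h = NP.+-cancelʳ-≤ (j * i) (N + 2) (suc j + l + K) weighted
    where
    lhs : ∀ N j i → N + j * i + 2 ≡ N + 2 + j * i
    lhs = solve-∀
    rhs : ∀ j l K i → j + suc l + (K + i) ≡ suc j + l + K + i
    rhs = solve-∀
    weighted : N + 2 + j * i ≤ suc j + l + K + j * i
    weighted = NP.≤-trans (P.subst₂ _≤_ (lhs N j i) (rhs j l K i) h) (NP.+-monoʳ-≤ (suc j + l + K) (NP.m≤n*m i j))

  bound-exhausted : ∀ n j k → n + 2 ≤ suc j + 0 + suc k → n < suc j * suc k
  bound-exhausted n j k h = s≤s (NP.≤-trans n≤j+k j+k≤k+jk)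
    where
    shape : ∀ j k → suc j + 0 + suc k ≡ 2 + (j + k)
    shape = solve-∀
    n≤j+k : n ≤ j + k
    n≤j+k = NP.+-cancelˡ-≤ 2 n (j + k) (P.subst₂ _≤_ (NP.+-comm n 2) (shape j k) h)
    j+k≤k+jk : j + k ≤ k + j * suc k
    j+k≤k+jk = P.subst (_≤ k + j * suc k) (NP.+-comm k j) (NP.+-monoʳ-≤ k (NP.m≤m*n j (suc k)))

  bound-initial : ∀ n k → k ≤ n → n + 2 ≤ 1 + suc (n ∸ k) + k
  bound-initial n k k≤n = P.subst (λ z → z + 2 ≤ 1 + suc (n ∸ k) + k) (NP.m∸n+n≡m k≤n) (NP.≤-reflexive (shape (n ∸ k) k))
    where
    shape : ∀ d k → d + k + 2 ≡ 1 + suc d + k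
    shape = solve-∀

  remaining-degree : ∀ j i n k → j ≤ i → i ≤ n → n < j + j * k → n ∸ i < j * k
  remaining-degree j i n k j≤i i≤n n<j+jk = NP.≤-<-trans (NP.∸-monoʳ-≤ n j≤i) (NP.+-cancelʳ-< j (n ∸ j) (j * k) shifted)
    where
    shifted : n ∸ j + j < j * k + j
    shifted = P.subst₂ _<_ (P.sym (NP.m∸n+n≡m (NP.≤-trans j≤i i≤n))) (NP.+-comm j (j * k)) n<j+jk

open ExponentBounds

module FiniteSums {c ℓ} (R : CommutativeRing c ℓ) where
  open CommutativeRing R
  open RingOps R
  open import Relation.Binary.Reasoning.Setoid setoid
  module +-CS = CommSemigroupProperties +-commutativeSemigroup
  module *-CS = CommSemigroupProperties *-commutativeSemigroup

  sum-cong : ∀ {f g : ℕ → Carrier} n → (∀ i → i < n → f i ≈ g i) → sumTo f n ≈ sumTo g n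
  sum-cong zero f≈g = refl
  sum-cong (suc n) f≈g = +-cong (sum-cong n (λ i i<n → f≈g i (NP.m<n⇒m<1+n i<n))) (f≈g n NP.≤-refl)

  sum-zero : ∀ {f : ℕ → Carrier} n → (∀ i → i < n → f i ≈ 0#) → sumTo f n ≈ 0#
  sum-zero zero f≈0 = refl
  sum-zero (suc n) f≈0 = trans (+-cong (sum-zero n (λ i i<n → f≈0 i (NP.m<n⇒m<1+n i<n))) (f≈0 n NP.≤-refl)) (+-identityˡ 0#)

  sum-+ : ∀ (f g : ℕ → Carrier) n → sumTo (λ i → f i + g i) n ≈ sumTo f n + sumTo g n
  sum-+ f g zero = sym (+-identityˡ 0#)
  sum-+ f g (suc n) = trans (+-cong (sum-+ f g n) refl) (+-CS.interchange _ _ _ _)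

  sum-*ˡ : ∀ α (f : ℕ → Carrier) n → α * sumTo f n ≈ sumTo (λ i → α * f i) n
  sum-*ˡ α f zero = zeroʳ α
  sum-*ˡ α f (suc n) = trans (distribˡ α (sumTo f n) (f n)) (+-cong (sum-*ˡ α f n) refl)

  sum-head : ∀ (f : ℕ → Carrier) n → sumTo f (suc n) ≈ f 0 + sumTo (λ i → f (suc i)) n
  sum-head f zero = trans (+-identityˡ (f 0)) (sym (+-identityʳ (f 0)))
  sum-head f (suc n) = trans (+-cong (sum-head f n) refl) (+-assoc _ _ _)

  sum-swap : ∀ (F : ℕ → ℕ → Carrier) n m →
    sumTo (λ i → sumTo (λ j → F i j) m) n ≈ sumTo (λ j → sumTo (λ i → F i j) n) m
  sum-swap F zero m = sym (sum-zero m (λ _ _ → refl))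
  sum-swap F (suc n) m = trans (+-cong (sum-swap F n m) refl) (sym (sum-+ _ _ m))

  sum-extend : ∀ {f : ℕ → Carrier} m d → (∀ i → m ≤ i → f i ≈ 0#) → sumTo f (d ℕ.+ m) ≈ sumTo f m
  sum-extend m zero f≈0 = refl
  sum-extend m (suc d) f≈0 = trans (+-cong (sum-extend m d f≈0) (f≈0 (d ℕ.+ m) (NP.m≤n+m m d))) (+-identityʳ _)

  ι-+ : ∀ m n → ι (m ℕ.+ n) ≈ ι m + ι n
  ι-+ zero n = sym (+-identityˡ (ι n))
  ι-+ (suc m) n = trans (+-cong refl (ι-+ m n)) (sym (+-assoc 1# (ι m) (ι n)))

  ^-+ : ∀ x m n → x ^ (m ℕ.+ n) ≈ (x ^ m) * (x ^ n)
  ^-+ x zero n = sym (*-identityˡ _)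
  ^-+ x (suc m) n = trans (*-cong refl (^-+ x m n)) (sym (*-assoc _ _ _))

  sumList-cong : ∀ {A : Set} {f g : A → Carrier} xs → (∀ x → f x ≈ g x) → sumList (map f xs) ≈ sumList (map g xs)
  sumList-cong [] f≈g = refl
  sumList-cong (x ∷ xs) f≈g = +-cong (f≈g x) (sumList-cong xs f≈g)

  sumList-zero : ∀ {A : Set} (f : A → Carrier) xs → (∀ x → f x ≈ 0#) → sumList (map f xs) ≈ 0#
  sumList-zero f [] f≈0 = refl
  sumList-zero f (x ∷ xs) f≈0 = trans (+-cong (f≈0 x) (sumList-zero f xs f≈0)) (+-identityˡ 0#)

  sumList-*ˡ : ∀ {A : Set} α (f : A → Carrier) xs → α * sumList (map f xs) ≈ sumList (map (λ x → α * f x) xs)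
  sumList-*ˡ α f [] = zeroʳ α
  sumList-*ˡ α f (x ∷ xs) = trans (distribˡ _ _ _) (+-cong refl (sumList-*ˡ α f xs))

  sumList-++ : ∀ xs ys → sumList (xs ++ ys) ≈ sumList xs + sumList ys
  sumList-++ [] ys = sym (+-identityˡ _)
  sumList-++ (x ∷ xs) ys = trans (+-cong refl (sumList-++ xs ys)) (sym (+-assoc _ _ _))

  sumList-concatMap : ∀ {A B : Set} (f : B → Carrier) (G : A → List B) xs →
    sumList (map f (concatMap G xs)) ≈ sumList (map (λ x → sumList (map f (G x))) xs)
  sumList-concatMap f G [] = refl
  sumList-concatMap f G (x ∷ xs) = begin
    sumList (map f (G x ++ concatMap G xs))          ≡⟨ P.cong sumList (LP.map-++ f (G x) (concatMap G xs)) ⟩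
    sumList (map f (G x) ++ map f (concatMap G xs))  ≈⟨ sumList-++ (map f (G x)) (map f (concatMap G xs)) ⟩
    sumList (map f (G x)) + sumList (map f (concatMap G xs)) ≈⟨ +-cong refl (sumList-concatMap f G xs) ⟩
    sumList (map f (G x)) + sumList (map (λ y → sumList (map f (G y))) xs) ∎

  sumList-applyUpTo : ∀ (f : ℕ → Carrier) (h : ℕ → ℕ) n → sumList (map f (applyUpTo h n)) ≈ sumTo (λ i → f (h i)) n
  sumList-applyUpTo f h zero = refl
  sumList-applyUpTo f h (suc n) = trans (+-cong refl (sumList-applyUpTo f (λ i → h (suc i)) n)) (sym (sum-head _ n))

  when : Bool → Carrier → Carrier
  when true x = x
  when false x = 0#

  when-*ˡ : ∀ b x y → when b (x * y) ≈ x * when b y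
  when-*ˡ true x y = refl
  when-*ˡ false x y = sym (zeroʳ x)

  sumList-filter : ∀ {A : Set} {Q : A → Set} (Q? : ∀ x → Dec (Q x)) (f : A → Carrier) xs →
    sumList (map f (filter Q? xs)) ≈ sumList (map (λ x → when (does (Q? x)) (f x)) xs)
  sumList-filter Q? f [] = refl
  sumList-filter Q? f (x ∷ xs) with does (Q? x)
  ... | true = +-cong refl (sumList-filter Q? f xs)
  ... | false = trans (sumList-filter Q? f xs) (sym (+-identityˡ _))

module PowerSeries {c ℓ} (R : CommutativeRing c ℓ) (inv : ℕ → CommutativeRing.Carrier R)
                   (lam : CommutativeRing.Carrier R) where
  open CommutativeRing R
  open RingOps R
  open Ops R inv lam
  open FiniteSums R
  open import Relation.Binary.Reasoning.Setoid setoid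

  _≋_ : Series → Series → Set ℓ
  f ≋ g = ∀ m → f m ≈ g m

  mulS-cong : ∀ {f f′ g g′ : Series} → f ≋ f′ → g ≋ g′ → mulS f g ≋ mulS f′ g′
  mulS-cong f≋f′ g≋g′ n = sum-cong (suc n) (λ i _ → *-cong (f≋f′ i) (g≋g′ (n ∸ i)))

  powS-cong : ∀ {f f′ : Series} → f ≋ f′ → ∀ k → powS f k ≋ powS f′ k
  powS-cong f≋f′ zero = λ _ → refl
  powS-cong f≋f′ (suc k) = mulS-cong f≋f′ (powS-cong f≋f′ k)

  mulS-+ˡ : ∀ (f g h : Series) n → mulS (λ m → f m + g m) h n ≈ mulS f h n + mulS g h n
  mulS-+ˡ f g h n = trans (sum-cong (suc n) (λ i _ → distribʳ _ _ _)) (sum-+ _ _ (suc n))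

  mulS-*ʳ : ∀ (f h : Series) α n → mulS f (λ m → α * h m) n ≈ α * mulS f h n
  mulS-*ʳ f h α n = trans (sum-cong (suc n) (λ i _ → *-CS.x∙yz≈y∙xz _ _ _)) (sym (sum-*ˡ α _ (suc n)))

  mulS-sumʳ : ∀ (f : Series) (H : ℕ → Series) K n →
    mulS f (λ m → sumTo (λ i → H i m) K) n ≈ sumTo (λ i → mulS f (H i) n) K
  mulS-sumʳ f H K n = trans (sum-cong (suc n) (λ j _ → sum-*ˡ (f j) _ K)) (sum-swap _ (suc n) K)

  shift : ℕ → Series → Series
  shift zero h n = h n
  shift (suc d) h zero = 0#
  shift (suc d) h (suc n) = shift d h n

  shift-cong : ∀ {h h′ : Series} → h ≋ h′ → ∀ d → shift d h ≋ shift d h′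
  shift-cong h≋h′ zero n = h≋h′ n
  shift-cong h≋h′ (suc d) zero = refl
  shift-cong h≋h′ (suc d) (suc n) = shift-cong h≋h′ d n

  shift-*ˡ : ∀ (h : Series) α d n → shift d (λ m → α * h m) n ≈ α * shift d h n
  shift-*ˡ h α zero n = refl
  shift-*ˡ h α (suc d) zero = sym (zeroʳ α)
  shift-*ˡ h α (suc d) (suc n) = shift-*ˡ h α d n

  shift-+ : ∀ (h h′ : Series) d n → shift d (λ m → h m + h′ m) n ≈ shift d h n + shift d h′ n
  shift-+ h h′ zero n = refl
  shift-+ h h′ (suc d) zero = sym (+-identityˡ 0#)
  shift-+ h h′ (suc d) (suc n) = shift-+ h h′ d n

  shift-sum : ∀ (H : ℕ → Series) K d n → shift d (λ m → sumTo (λ i → H i m) K) n ≈ sumTo (λ i → shift d (H i) n) K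
  shift-sum H K zero n = refl
  shift-sum H K (suc d) zero = sym (sum-zero K (λ _ _ → refl))
  shift-sum H K (suc d) (suc n) = shift-sum H K d n

  shift-+-shift : ∀ (h : Series) d e n → shift (d ℕ.+ e) h n ≡ shift d (shift e h) n
  shift-+-shift h zero e n = P.refl
  shift-+-shift h (suc d) e zero = P.refl
  shift-+-shift h (suc d) e (suc n) = shift-+-shift h d e n

  shift-below : ∀ (h : Series) d n → n < d → shift d h n ≈ 0#
  shift-below h (suc d) zero _ = refl
  shift-below h (suc d) (suc n) (s≤s n<d) = shift-below h d n n<d

  shift-above : ∀ (h : Series) d n → d ≤ n → shift d h n ≡ h (n ∸ d)
  shift-above h zero n _ = P.refl
  shift-above h (suc d) (suc n) (s≤s d≤n) = shift-above h d n d≤n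

  mulS-shiftʳ : ∀ (f h : Series) d n → mulS f (shift d h) n ≈ shift d (mulS f h) n
  mulS-shiftʳ f h zero n = refl
  mulS-shiftʳ f h (suc d) zero = trans (+-identityˡ _) (zeroʳ (f 0))
  mulS-shiftʳ f h (suc d) (suc n) = begin
    sumTo (λ i → f i * shift (suc d) h (suc n ∸ i)) (suc n) + f (suc n) * shift (suc d) h (suc n ∸ suc n)
      ≈⟨ +-cong (sum-cong (suc n) (λ i i<sn → reflexive (P.cong (λ z → f i * shift (suc d) h z) (NP.+-∸-assoc 1 (NP.≤-pred i<sn)))))
                (trans (*-cong refl (reflexive (P.cong (shift (suc d) h) (NP.n∸n≡0 n)))) (zeroʳ _)) ⟩
    mulS f (shift d h) n + 0# ≈⟨ +-identityʳ _ ⟩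
    mulS f (shift d h) n      ≈⟨ mulS-shiftʳ f h d n ⟩
    shift d (mulS f h) n ∎

  monomial : ℕ → Carrier → Series
  monomial d α = shift d (λ m → α * oneS m)

  mulS-monomialˡ : ∀ (h : Series) α d n → mulS (monomial d α) h n ≈ α * shift d h n
  mulS-monomialˡ h α zero n = begin
    sumTo (λ i → (α * oneS i) * h (n ∸ i)) (suc n) ≈⟨ sum-head _ n ⟩
    (α * 1#) * h n + sumTo (λ i → (α * 0#) * h (n ∸ suc i)) n
      ≈⟨ +-cong (*-cong (*-identityʳ α) refl) (sum-zero n (λ i _ → trans (*-cong (zeroʳ α) refl) (zeroˡ _))) ⟩
    α * h n + 0# ≈⟨ +-identityʳ _ ⟩
    α * h n ∎
  mulS-monomialˡ h α (suc d) zero = trans (+-identityˡ _) (trans (zeroˡ _) (sym (zeroʳ α)))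
  mulS-monomialˡ h α (suc d) (suc n) = begin
    mulS (monomial (suc d) α) h (suc n)     ≈⟨ sum-head _ (suc n) ⟩
    0# * h (suc n) + mulS (monomial d α) h n ≈⟨ +-cong (zeroˡ _) (mulS-monomialˡ h α d n) ⟩
    0# + α * shift d h n                    ≈⟨ +-identityˡ _ ⟩
    α * shift d h n ∎

module ExponentialBinomial {c ℓ} (R : CommutativeRing c ℓ) (inv : ℕ → CommutativeRing.Carrier R)
  (inv-correct : ∀ m → CommutativeRing._≈_ R (CommutativeRing._*_ R (RingOps.ι R (suc m)) (inv m)) (CommutativeRing.1# R))
  (lam : CommutativeRing.Carrier R) where
  open CommutativeRing R
  open RingOps R
  open Ops R inv lam
  open FiniteSums R
  open PowerSeries R inv lam
  open import Relation.Binary.Reasoning.Setoid setoid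

  ι-invFact : ∀ k → ι (suc k) * invFact (suc k) ≈ invFact k
  ι-invFact k = begin
    ι (suc k) * (inv k * invFact k) ≈⟨ sym (*-assoc _ _ _) ⟩
    (ι (suc k) * inv k) * invFact k ≈⟨ *-cong (inv-correct k) refl ⟩
    1# * invFact k                  ≈⟨ *-identityˡ _ ⟩
    invFact k ∎

  ι-cancel : ∀ k {x y} → ι (suc k) * x ≈ ι (suc k) * y → x ≈ y
  ι-cancel k {x} {y} kx≈ky = begin
    x                               ≈⟨ sym (*-identityˡ x) ⟩
    1# * x                          ≈⟨ *-cong (sym (inv-correct k)) refl ⟩
    (ι (suc k) * inv k) * x         ≈⟨ *-CS.xy∙z≈y∙xz _ _ _ ⟩
    inv k * (ι (suc k) * x)         ≈⟨ *-cong refl kx≈ky ⟩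
    inv k * (ι (suc k) * y)         ≈⟨ sym (*-CS.xy∙z≈y∙xz _ _ _) ⟩
    (ι (suc k) * inv k) * y         ≈⟨ *-cong (inv-correct k) refl ⟩
    1# * y                          ≈⟨ *-identityˡ y ⟩
    y ∎

  divPow : Series → ℕ → Series
  divPow S r m = invFact r * powS S r m

  mulS-divPow : ∀ (S : Series) r m → mulS S (divPow S r) m ≈ ι (suc r) * divPow S (suc r) m
  mulS-divPow S r m = begin
    mulS S (divPow S r) m                          ≈⟨ mulS-*ʳ S (powS S r) (invFact r) m ⟩
    invFact r * powS S (suc r) m                   ≈⟨ *-cong (sym (ι-invFact r)) refl ⟩
    (ι (suc r) * invFact (suc r)) * powS S (suc r) m ≈⟨ *-assoc _ _ _ ⟩
    ι (suc r) * divPow S (suc r) m ∎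

  module Binomial (d : ℕ) (α : Carrier) (S : Series) where
    E : Series
    E m = monomial d α m + S m

    term : ℕ → ℕ → Series
    term i r m = (invFact i * α ^ i) * shift (d ℕ.* i) (divPow S r) m

    monomial-step : ∀ i r n → α * shift d (term i r) n ≈ ι (suc i) * term (suc i) r n
    monomial-step i r n = begin
      α * shift d (term i r) n ≈⟨ *-cong refl (shift-*ˡ _ _ d n) ⟩
      α * (cᵢ * shift d (shift (d ℕ.* i) (divPow S r)) n)
        ≈⟨ *-cong refl (*-cong refl (reflexive (P.trans (P.sym (shift-+-shift (divPow S r) d (d ℕ.* i) n))
                                                        (P.cong (λ e → shift e (divPow S r) n) (P.sym (NP.*-suc d i)))))) ⟩
      α * (cᵢ * X)             ≈⟨ sym (*-assoc _ _ _) ⟩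
      (α * cᵢ) * X             ≈⟨ *-cong (sym coefficient) refl ⟩
      (ι (suc i) * ((inv i * invFact i) * (α * α ^ i))) * X ≈⟨ *-assoc _ _ _ ⟩
      ι (suc i) * term (suc i) r n ∎
      where
      cᵢ = invFact i * α ^ i
      X = shift (d ℕ.* suc i) (divPow S r) n
      coefficient : ι (suc i) * ((inv i * invFact i) * (α * α ^ i)) ≈ α * cᵢ
      coefficient = begin
        ι (suc i) * ((inv i * invFact i) * (α * α ^ i)) ≈⟨ sym (*-assoc _ _ _) ⟩
        (ι (suc i) * invFact (suc i)) * (α * α ^ i)     ≈⟨ *-cong (ι-invFact i) refl ⟩
        invFact i * (α * α ^ i)                         ≈⟨ *-CS.x∙yz≈y∙xz _ _ _ ⟩
        α * cᵢ ∎

    series-step : ∀ i r n → mulS S (term i r) n ≈ ι (suc r) * term i (suc r) n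
    series-step i r n = begin
      mulS S (term i r) n                          ≈⟨ mulS-*ʳ S (shift (d ℕ.* i) (divPow S r)) cᵢ n ⟩
      cᵢ * mulS S (shift (d ℕ.* i) (divPow S r)) n  ≈⟨ *-cong refl (mulS-shiftʳ S _ (d ℕ.* i) n) ⟩
      cᵢ * shift (d ℕ.* i) (mulS S (divPow S r)) n  ≈⟨ *-cong refl (shift-cong (mulS-divPow S r) (d ℕ.* i) n) ⟩
      cᵢ * shift (d ℕ.* i) (λ m → ι (suc r) * divPow S (suc r) m) n ≈⟨ *-cong refl (shift-*ˡ _ _ (d ℕ.* i) n) ⟩
      cᵢ * (ι (suc r) * shift (d ℕ.* i) (divPow S (suc r)) n) ≈⟨ *-CS.x∙yz≈y∙xz _ _ _ ⟩
      ι (suc r) * term i (suc r) n ∎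
      where cᵢ = invFact i * α ^ i

    -- Both sides of the (k+1)-st binomial identity, multiplied by k+1, equal
    --   Σ_{i≤k} (i+1) term (i+1) (k-i)  +  Σ_{i≤k} (k-i+1) term i (k-i+1).
    pascal : ℕ → ℕ → Carrier
    pascal k n = sumTo (λ i → ι (suc i) * term (suc i) (k ∸ i) n) (suc k)
               + sumTo (λ i → ι (suc (k ∸ i)) * term i (suc (k ∸ i)) n) (suc k)

    -- Writing k+1 = i + (k+1-i) in the i-th term.
    pascal-split : ∀ k n → ι (suc k) * sumTo (λ i → term i (suc k ∸ i) n) (suc (suc k)) ≈ pascal k n
    pascal-split k n = begin
      ι (suc k) * sumTo F (suc (suc k))                   ≈⟨ sum-*ˡ _ _ (suc (suc k)) ⟩
      sumTo (λ i → ι (suc k) * F i) (suc (suc k))         ≈⟨ sum-cong (suc (suc k)) split ⟩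
      sumTo (λ i → ι i * F i + ι (suc k ∸ i) * F i) (suc (suc k)) ≈⟨ sum-+ _ _ (suc (suc k)) ⟩
      sumTo (λ i → ι i * F i) (suc (suc k)) + sumTo (λ i → ι (suc k ∸ i) * F i) (suc (suc k)) ≈⟨ +-cong first second ⟩
      pascal k n ∎
      where
      F : ℕ → Carrier
      F i = term i (suc k ∸ i) n
      split : ∀ i → i < suc (suc k) → ι (suc k) * F i ≈ ι i * F i + ι (suc k ∸ i) * F i
      split i i<k+2 = trans (*-cong (trans (reflexive (P.cong ι (P.sym (NP.m+[n∸m]≡n (NP.≤-pred i<k+2))))) (ι-+ i (suc k ∸ i))) refl)
                            (distribʳ _ _ _)
      first : sumTo (λ i → ι i * F i) (suc (suc k)) ≈ sumTo (λ i → ι (suc i) * term (suc i) (k ∸ i) n) (suc k)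
      first = trans (sum-head _ (suc k)) (trans (+-cong (zeroˡ _) refl) (+-identityˡ _))
      second : sumTo (λ i → ι (suc k ∸ i) * F i) (suc (suc k)) ≈ sumTo (λ i → ι (suc (k ∸ i)) * term i (suc (k ∸ i)) n) (suc k)
      second = trans (+-cong (sum-cong (suc k) (λ i i<k+1 → reflexive (P.cong (λ r → ι r * term i r n) (NP.+-∸-assoc 1 (NP.≤-pred i<k+1)))))
                             (trans (*-cong (reflexive (P.cong ι (NP.n∸n≡0 k))) refl) (zeroˡ _)))
                     (+-identityʳ _)

    binomial : ∀ k n → invFact k * powS E k n ≈ sumTo (λ i → term i (k ∸ i) n) (suc k)
    binomial zero n = sym (begin
      0# + (1# * 1#) * shift (d ℕ.* 0) (divPow S 0) n ≈⟨ +-identityˡ _ ⟩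
      (1# * 1#) * shift (d ℕ.* 0) (divPow S 0) n      ≈⟨ *-cong (*-identityˡ _) (reflexive (P.cong (λ e → shift e (divPow S 0) n) (NP.*-zeroʳ d))) ⟩
      1# * (1# * oneS n)                              ≈⟨ *-identityˡ _ ⟩
      1# * oneS n ∎)
    binomial (suc k) n = ι-cancel k (trans expand (sym (pascal-split k n)))
      where
      Σₖ : Series
      Σₖ m = sumTo (λ i → term i (k ∸ i) m) (suc k)
      expand : ι (suc k) * (invFact (suc k) * powS E (suc k) n) ≈ pascal k n
      expand = begin
        ι (suc k) * (invFact (suc k) * mulS E (powS E k) n) ≈⟨ sym (*-assoc _ _ _) ⟩
        (ι (suc k) * invFact (suc k)) * mulS E (powS E k) n ≈⟨ *-cong (ι-invFact k) refl ⟩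
        invFact k * mulS E (powS E k) n                     ≈⟨ sym (mulS-*ʳ E (powS E k) (invFact k) n) ⟩
        mulS E (divPow E k) n                               ≈⟨ mulS-cong (λ _ → refl) (binomial k) n ⟩
        mulS E Σₖ n                                         ≈⟨ mulS-+ˡ (monomial d α) S Σₖ n ⟩
        mulS (monomial d α) Σₖ n + mulS S Σₖ n
          ≈⟨ +-cong (mulS-monomialˡ Σₖ α d n) (mulS-sumʳ S (λ i → term i (k ∸ i)) (suc k) n) ⟩
        α * shift d Σₖ n + sumTo (λ i → mulS S (term i (k ∸ i)) n) (suc k)
          ≈⟨ +-cong (trans (*-cong refl (shift-sum _ (suc k) d n)) (sum-*ˡ α _ (suc k))) refl ⟩
        sumTo (λ i → α * shift d (term i (k ∸ i)) n) (suc k) + sumTo (λ i → mulS S (term i (k ∸ i)) n) (suc k)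
          ≈⟨ +-cong (sum-cong (suc k) (λ i _ → monomial-step i (k ∸ i) n)) (sum-cong (suc k) (λ i _ → series-step i (k ∸ i) n)) ⟩
        pascal k n ∎

module Multinomial {c ℓ} (R : CommutativeRing c ℓ) (inv : ℕ → CommutativeRing.Carrier R)
  (inv-correct : ∀ m → CommutativeRing._≈_ R (CommutativeRing._*_ R (RingOps.ι R (suc m)) (inv m)) (CommutativeRing.1# R))
  (lam : CommutativeRing.Carrier R) where
  open CommutativeRing R
  open RingOps R
  open Ops R inv lam
  open FiniteSums R
  open PowerSeries R inv lam
  open ExponentialBinomial R inv inv-correct lam
  open import Relation.Binary.Reasoning.Setoid setoid

  coef : ℕ → Carrier
  coef m = a m * invFact m

  tail : ℕ → Series
  tail j = shift j (λ r → coef (j ℕ.+ r))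

  tail-split : ∀ j → tail j ≋ (λ m → monomial j (coef j) m + tail (suc j) m)
  tail-split j m = begin
    shift j u m                                        ≈⟨ shift-cong split-first j m ⟩
    shift j (λ r → u 0 * oneS r + shift 1 u′ r) m       ≈⟨ shift-+ (λ r → u 0 * oneS r) (shift 1 u′) j m ⟩
    shift j (λ r → u 0 * oneS r) m + shift j (shift 1 u′) m
      ≈⟨ +-cong (shift-cong (λ r → *-cong (reflexive (P.cong coef (NP.+-identityʳ j))) refl) j m)
                (trans (reflexive shift-shift-1) (shift-cong (λ s → reflexive (P.cong coef (NP.+-suc j s))) (suc j) m)) ⟩
    monomial j (coef j) m + tail (suc j) m ∎
    where
    u u′ : Series
    u r = coef (j ℕ.+ r)
    u′ s = u (suc s)
    split-first : ∀ r → u r ≈ u 0 * oneS r + shift 1 u′ r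
    split-first zero = sym (trans (+-identityʳ _) (*-identityʳ _))
    split-first (suc r) = sym (trans (+-cong (zeroʳ _) refl) (+-identityˡ _))
    shift-shift-1 : shift j (shift 1 u′) m ≡ shift (suc j) u′ m
    shift-shift-1 = P.trans (P.sym (shift-+-shift u′ j 1 m)) (P.cong (λ e → shift e u′ m) (NP.+-comm j 1))

  -- Every term of tail j has degree ≥ j, so tail j ^ k has no terms below degree j k.
  tail-pow-vanish : ∀ j k n → n < j ℕ.* k → powS (tail j) k n ≈ 0#
  tail-pow-vanish j zero n n<0 = ⊥-elim (NP.n≮0 (P.subst (n <_) (NP.*-zeroʳ j) n<0))
  tail-pow-vanish j (suc k) n n<jk = sum-zero (suc n) product-zero
    where
    product-zero : ∀ i → i < suc n → tail j i * powS (tail j) k (n ∸ i) ≈ 0#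
    product-zero i i<n+1 with i NP.<? j
    ... | yes i<j = trans (*-cong (shift-below _ j i i<j) refl) (zeroˡ _)
    ... | no i≮j = trans (*-cong refl (tail-pow-vanish j k (n ∸ i) rest<jk)) (zeroʳ _)
      where
      rest<jk : n ∸ i < j ℕ.* k
      rest<jk = remaining-degree j i n k (NP.≮⇒≥ i≮j) (NP.≤-pred i<n+1) (P.subst (n <_) (NP.*-suc j k) n<jk)

  constraints? : (j k n : ℕ) → ∀ {l} (v : Vec ℕ l) → Dec ((sumV v ≡ k) × (wsumFrom j v ≡ n))
  constraints? j k n v = (sumV v ℕ.≟ k) ×-dec (wsumFrom j v ℕ.≟ n)

  summand : (j k n : ℕ) → ∀ {l} → Vec ℕ l → Carrier
  summand j k n v = when (does (constraints? j k n v)) (prodFrom j v)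

  constrainedSum : (j l b k n : ℕ) → Carrier
  constrainedSum j l b k n = sumList (map (summand j k n) (vecs l b))

  firstExponent : (j l b k n i : ℕ) → Carrier
  firstExponent j l b k n i = sumList (map (λ v → summand j k n (i ∷ v)) (vecs l b))

  constrainedSum-suc : ∀ j l b k n → constrainedSum j (suc l) b k n ≈ sumTo (firstExponent j l b k n) (suc b)
  constrainedSum-suc j l b k n = begin
    sumList (map f (concatMap (λ i → map (i ∷_) (vecs l b)) (upTo (suc b))))
      ≈⟨ sumList-concatMap f (λ i → map (i ∷_) (vecs l b)) (upTo (suc b)) ⟩
    sumList (map (λ i → sumList (map f (map (i ∷_) (vecs l b)))) (upTo (suc b)))
      ≈⟨ sumList-cong (upTo (suc b)) (λ i → reflexive (P.cong sumList (P.sym (LP.map-∘ (vecs l b))))) ⟩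
    sumList (map (firstExponent j l b k n) (upTo (suc b)))
      ≈⟨ sumList-applyUpTo (firstExponent j l b k n) (λ i → i) (suc b) ⟩
    sumTo (firstExponent j l b k n) (suc b) ∎
    where
    f = summand j k n

  firstExponent-infeasible : ∀ j l b k n i → (∀ {s w} → ¬ ((i ℕ.+ s ≡ k) × (j ℕ.* i ℕ.+ w ≡ n))) →
    firstExponent j l b k n i ≈ 0#
  firstExponent-infeasible j l b k n i infeasible =
    sumList-zero _ (vecs l b) (λ v → reflexive (P.cong (λ z → when z _) (dec-false (constraints? j k n (i ∷ v)) infeasible)))

  firstExponent-factor : ∀ j l b k n i → i ≤ k → j ℕ.* i ≤ n →
    firstExponent j l b k n i ≈ (invFact i * coef j ^ i) * constrainedSum (suc j) l b (k ∸ i) (n ∸ j ℕ.* i)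
  firstExponent-factor j l b k n i i≤k ji≤n = begin
    firstExponent j l b k n i ≈⟨ sumList-cong (vecs l b) factor ⟩
    sumList (map (λ v → cᵢ * summand (suc j) k′ n′ v) (vecs l b)) ≈⟨ sym (sumList-*ˡ cᵢ (summand (suc j) k′ n′) (vecs l b)) ⟩
    cᵢ * constrainedSum (suc j) l b k′ n′ ∎
    where
    cᵢ = invFact i * coef j ^ i
    k′ = k ∸ i
    n′ = n ∸ j ℕ.* i
    forward : ∀ {s w} → (i ℕ.+ s ≡ k) × (j ℕ.* i ℕ.+ w ≡ n) → (s ≡ k′) × (w ≡ n′)
    forward {s} {w} (s-eq , w-eq) =
      P.trans (P.sym (NP.m+n∸m≡n i s)) (P.cong (_∸ i) s-eq) ,
      P.trans (P.sym (NP.m+n∸m≡n (j ℕ.* i) w)) (P.cong (_∸ (j ℕ.* i)) w-eq)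
    backward : ∀ {s w} → (s ≡ k′) × (w ≡ n′) → (i ℕ.+ s ≡ k) × (j ℕ.* i ℕ.+ w ≡ n)
    backward (P.refl , P.refl) = NP.m+[n∸m]≡n i≤k , NP.m+[n∸m]≡n ji≤n
    factor : ∀ v → summand j k n (i ∷ v) ≈ cᵢ * summand (suc j) k′ n′ v
    factor v = trans (reflexive (P.cong (λ z → when z (cᵢ * prodFrom (suc j) v))
                                        (does-≡ (map′ forward backward (constraints? j k n (i ∷ v))) (constraints? (suc j) k′ n′ v))))
                     (when-*ˡ (does (constraints? (suc j) k′ n′ v)) cᵢ (prodFrom (suc j) v))

  expansion : ∀ b l j k n → 1 ≤ j → k ≤ b → n ℕ.+ 2 ≤ j ℕ.+ l ℕ.+ k →
    divPow (tail j) k n ≈ constrainedSum j l b k n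
  expansion b zero (suc j) zero zero _ _ _ = trans (*-identityˡ _) (sym (+-identityʳ _))
  expansion b zero (suc j) zero (suc n) _ _ _ = trans (zeroʳ _) (sym (+-identityˡ _))
  expansion b zero (suc j) (suc k) n _ _ bound =
    trans (*-cong refl (tail-pow-vanish (suc j) (suc k) n (bound-exhausted n j k bound))) (trans (zeroʳ _) (sym (+-identityˡ _)))
  expansion b (suc l) j@(suc _) k n _ k≤b bound = begin
    divPow (tail j) k n                     ≈⟨ *-cong refl (powS-cong (tail-split j) k n) ⟩
    invFact k * powS E k n                  ≈⟨ binomial k n ⟩
    sumTo (λ i → term i (k ∸ i) n) (suc k)  ≈⟨ sym (sum-cong (suc k) (λ i i<k+1 → by-first-exponent i (NP.≤-pred i<k+1))) ⟩
    sumTo (firstExponent j l b k n) (suc k) ≈⟨ sym exponents-bounded-by-k ⟩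
    sumTo (firstExponent j l b k n) (suc b) ≈⟨ sym (constrainedSum-suc j l b k n) ⟩
    constrainedSum j (suc l) b k n ∎
    where
    open Binomial j (coef j) (tail (suc j))

    exponents-bounded-by-k : sumTo (firstExponent j l b k n) (suc b) ≈ sumTo (firstExponent j l b k n) (suc k)
    exponents-bounded-by-k = trans (reflexive (P.cong (sumTo _) b+1≡[b-k]+k+1))
      (sum-extend (suc k) (b ∸ k) (λ i k<i → firstExponent-infeasible j l b k n i
        (λ {s} (s-eq , _) → NP.<⇒≱ k<i (P.subst (i ≤_) s-eq (NP.m≤m+n i s)))))
      where
      b+1≡[b-k]+k+1 : suc b ≡ (b ∸ k) ℕ.+ suc k
      b+1≡[b-k]+k+1 = P.trans (P.cong suc (P.sym (NP.m∸n+n≡m k≤b))) (P.sym (NP.+-suc (b ∸ k) k))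

    by-first-exponent : ∀ i → i ≤ k → firstExponent j l b k n i ≈ term i (k ∸ i) n
    by-first-exponent i i≤k with j ℕ.* i NP.≤? n
    ... | no ji≰n = trans
      (firstExponent-infeasible j l b k n i (λ {_} {w} (_ , w-eq) → ji≰n (P.subst (j ℕ.* i ≤_) w-eq (NP.m≤m+n (j ℕ.* i) w))))
      (sym (trans (*-cong refl (shift-below _ (j ℕ.* i) n (NP.≰⇒> ji≰n))) (zeroʳ _)))
    ... | yes ji≤n = begin
      firstExponent j l b k n i                 ≈⟨ firstExponent-factor j l b k n i i≤k ji≤n ⟩
      cᵢ * constrainedSum (suc j) l b k′ n′     ≈⟨ *-cong refl (sym (expansion b l (suc j) k′ n′ (s≤s z≤n) k′≤b bound′)) ⟩
      cᵢ * divPow (tail (suc j)) k′ n′          ≈⟨ *-cong refl (reflexive (P.sym (shift-above (divPow (tail (suc j)) k′) (j ℕ.* i) n ji≤n))) ⟩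
      term i k′ n ∎
      where
      cᵢ = invFact i * coef j ^ i
      k′ = k ∸ i
      n′ = n ∸ j ℕ.* i
      k′≤b : k′ ≤ b
      k′≤b = NP.≤-trans (NP.m∸n≤m k i) k≤b
      bound′ : n′ ℕ.+ 2 ≤ suc j ℕ.+ l ℕ.+ k′
      bound′ = bound-drop-first n′ k′ i j l
        (P.subst₂ (λ n″ k″ → n″ ℕ.+ 2 ≤ j ℕ.+ suc l ℕ.+ k″) (P.sym (NP.m∸n+n≡m ji≤n)) (P.sym (NP.m∸n+n≡m i≤k)) bound)

module Corollary {c ℓ} (R : CommutativeRing c ℓ) (inv : ℕ → CommutativeRing.Carrier R)
  (inv-correct : ∀ m → CommutativeRing._≈_ R (CommutativeRing._*_ R (RingOps.ι R (suc m)) (inv m)) (CommutativeRing.1# R))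
  (lam x : CommutativeRing.Carrier R) where
  open CommutativeRing R
  open RingOps R
  open Ops R inv lam
  open FiniteSums R
  open PowerSeries R inv lam
  open ExponentialBinomial R inv inv-correct lam
  open Multinomial R inv inv-correct lam
  open RingProperties ring using (-1*x≈-x; -‿distribˡ-*; -‿distribʳ-*; -‿+-comm)
  open import Relation.Binary.Reasoning.Setoid setoid

  falling-neg : ∀ y m → falling (- y) m ≈ ((- 1#) ^ m) * rising y m
  falling-neg y zero = sym (*-identityˡ _)
  falling-neg y (suc m) = begin
    falling (- y) m * (- y - t)  ≈⟨ *-cong (falling-neg y m) (-‿+-comm y t) ⟩
    (s * r) * (- (y + t))        ≈⟨ sym (-‿distribʳ-* _ _) ⟩
    - ((s * r) * (y + t))        ≈⟨ -‿cong (*-assoc _ _ _) ⟩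
    - (s * (r * (y + t)))        ≈⟨ sym (-1*x≈-x _) ⟩
    (- 1#) * (s * (r * (y + t))) ≈⟨ sym (*-assoc _ _ _) ⟩
    ((- 1#) * s) * (r * (y + t)) ∎
    where
    s = (- 1#) ^ m
    r = rising y m
    t = ι m * lam

  diffS≋ones : diffS ≋ baseS (λ _ → 1#)
  diffS≋ones zero = -‿inverseʳ _
  diffS≋ones (suc m) = begin
    f * I - falling (- half) (suc m) * I ≈⟨ +-cong refl (-‿cong (*-cong (falling-neg half (suc m)) refl)) ⟩
    f * I - sr * I                       ≈⟨ +-cong refl (-‿distribˡ-* _ _) ⟩
    f * I + (- sr) * I                   ≈⟨ sym (distribʳ _ _ _) ⟩
    (f - sr) * I                         ≈⟨ *-cong (sym (*-identityˡ _)) refl ⟩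
    (1# * a (suc m)) * I ∎
    where
    f = falling half (suc m)
    I = invFact (suc m)
    sr = ((- 1#) ^ suc m) * rising half (suc m)

  ones≋tail : baseS (λ _ → 1#) ≋ tail 1
  ones≋tail zero = refl
  ones≋tail (suc m) = *-cong (*-identityˡ _) refl

  powS-homogeneous : ∀ {f f′ : Series} → (∀ m → f m ≈ (x ^ m) * f′ m) → ∀ k n → powS f k n ≈ (x ^ n) * powS f′ k n
  powS-homogeneous f≈xf′ zero zero = sym (*-identityˡ _)
  powS-homogeneous f≈xf′ zero (suc n) = sym (zeroʳ _)
  powS-homogeneous {f} {f′} f≈xf′ (suc k) n = trans (sum-cong (suc n) product) (sym (sum-*ˡ _ _ (suc n)))
    where
    product : ∀ i → i < suc n → f i * powS f k (n ∸ i) ≈ (x ^ n) * (f′ i * powS f′ k (n ∸ i))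
    product i i<n+1 = begin
      f i * powS f k (n ∸ i)                                      ≈⟨ *-cong (f≈xf′ i) (powS-homogeneous f≈xf′ k (n ∸ i)) ⟩
      ((x ^ i) * f′ i) * ((x ^ (n ∸ i)) * powS f′ k (n ∸ i))     ≈⟨ *-CS.interchange _ _ _ _ ⟩
      ((x ^ i) * (x ^ (n ∸ i))) * (f′ i * powS f′ k (n ∸ i))     ≈⟨ *-cong x^n-split refl ⟩
      (x ^ n) * (f′ i * powS f′ k (n ∸ i)) ∎
      where
      x^n-split : (x ^ i) * (x ^ (n ∸ i)) ≈ x ^ n
      x^n-split = trans (sym (^-+ x i (n ∸ i))) (reflexive (P.cong (x ^_) (NP.m+[n∸m]≡n (NP.≤-pred i<n+1))))

  powers≈x^m*ones : ∀ m → baseS (λ m → x ^ m) m ≈ (x ^ m) * baseS (λ _ → 1#) m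
  powers≈x^m*ones zero = sym (zeroʳ _)
  powers≈x^m*ones (suc m) = trans (*-assoc _ _ _) (*-cong refl (sym (*-cong (*-identityˡ _) refl)))

  homogeneity : ∀ n k → T n k (λ m → x ^ m) ≈ (x ^ n) * T n k (λ _ → 1#)
  homogeneity n k = begin
    fact n * (invFact k * powS (baseS (λ m → x ^ m)) k n)          ≈⟨ *-cong refl (*-cong refl (powS-homogeneous powers≈x^m*ones k n)) ⟩
    fact n * (invFact k * ((x ^ n) * powS (baseS (λ _ → 1#)) k n)) ≈⟨ *-cong refl (*-CS.x∙yz≈y∙xz _ _ _) ⟩
    fact n * ((x ^ n) * (invFact k * powS (baseS (λ _ → 1#)) k n)) ≈⟨ *-CS.x∙yz≈y∙xz _ _ _ ⟩
    (x ^ n) * T n k (λ _ → 1#) ∎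

  central≈bell : ∀ n k → T2 n k ≈ T n k (λ _ → 1#)
  central≈bell n k = *-cong refl (*-cong refl (powS-cong diffS≋ones k n))

  bell≈multinomial : ∀ n k → k ≤ n → T n k (λ _ → 1#) ≈ multSum n k
  bell≈multinomial n k k≤n = begin
    fact n * (invFact k * powS (baseS (λ _ → 1#)) k n) ≈⟨ *-cong refl (*-cong refl (powS-cong ones≋tail k n)) ⟩
    fact n * divPow (tail 1) k n                       ≈⟨ *-cong refl (expansion k (suc (n ∸ k)) 1 k n (s≤s z≤n) NP.≤-refl (bound-initial n k k≤n)) ⟩
    fact n * constrainedSum 1 (suc (n ∸ k)) k k n      ≈⟨ *-cong refl (sym (sumList-filter (constraints? 1 k n) (prodFrom 1) vectors)) ⟩
    fact n * sumList (map (prodFrom 1) (filter (constraints? 1 k n) vectors)) ≈⟨ sumList-*ˡ (fact n) (prodFrom 1) (filter (constraints? 1 k n) vectors) ⟩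
    multSum n k ∎
    where
    vectors = vecs (suc (n ∸ k)) k

corollary2p3 : ∀ {c ℓ} (R : CommutativeRing c ℓ) (inv : ℕ → CommutativeRing.Carrier R) →
    (∀ m → CommutativeRing._≈_ R (CommutativeRing._*_ R (RingOps.ι R (suc m)) (inv m)) (CommutativeRing.1# R)) →
    (lam x : CommutativeRing.Carrier R) →
    ∀ n k → k ≤ n → 2 ∣ (n ∸ k) →
    let open CommutativeRing R
        open RingOps R
        open Ops R inv lam
    in (T n k (λ m → x ^ m) ≈ (x ^ n) * T n k (λ _ → 1#))
       × ((x ^ n) * T n k (λ _ → 1#) ≈ (x ^ n) * T2 n k)
       × (T2 n k ≈ T n k (λ _ → 1#))
       × (T n k (λ _ → 1#) ≈ multSum n k)
corollary2p3 R inv inv-correct lam x n k k≤n _ =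
  homogeneity n k , *-cong refl (sym (central≈bell n k)) , central≈bell n k , bell≈multinomial n k k≤n
  where
  open CommutativeRing R using (*-cong; refl; sym)
  open Corollary R inv inv-correct lam x
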